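{- Let $G=G_1\cup G_2$ be a stochastic graph with distinguished node set $K=K_1\cup K_2$, where $G_1,G_2$ are stochastic subgraphs (edge parameters inherited from $G$) with no common edges, with distinguished sets $K_1\subseteq V(G_1)$, $K_2\subseteq V(G_2)$, and $K_1\cap K_2=V(G_1)\cap V(G_2)=\{k_1,\dots,k_n\}$. Assume every node $v\in K$ is joined by a path in $G$ to some $k_i$. Let $\mathcal{A}_1,\dots,\mathcal{A}_m$ be an enumeration of all partitions of $\{k_1,\dots,k_n\}$, let $A$ be the corresponding connectivity matrix and $(b_{ij})=A^{ -1}$. Then $$\mathcal{I}_{K}(G)=\sum_{i,j=1}^{m}b_{ij}\ \mathcal{I}_{K_1^{\mathcal{A}_i}}(G_{1}^{\mathcal{A}_{i}}) \ \mathcal{I}_{K_2^{\mathcal{A}_j}}(G_{2}^{\mathcal{A}_{j}})$$ in $\mathbb{R}[x]$, and the right-hand side does not depend on the chosen enumeration.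
   Context: Graphs $(V,E)$ are finite with edges $(\{a,b\},n)$, $a,b\in V$ (loops allowed), $n\in\mathbb{N}$, distinct edges having distinct labels. A stochastic graph assigns to each edge $e$ an independent Bernoulli variable with parameter $p_e\in[0,1]$. A state is $\mathcal{E}:E\to\{0,1\}$ with probability $P(\mathcal{E})=\prod_e p_e^{\mathcal{E}(e)}(1-p_e)^{1-\mathcal{E}(e)}$ and $\#\mathcal{E}=\#\mathcal{E}^{ -1}(1)$. For a distinguished set $K$, $\mathcal{E}$ is a $K$-PathSet if $K$ lies in the node set of one connected component of $(V,\mathcal{E}^{ -1}(1))$. Define $\mathcal{I}_K(G)=\sum_{i\ge0}a_ix^i\in\mathbb{R}[x]$ with $a_i=\sum P(\mathcal{E})$ over $K$-PathSets $\mathcal{E}$ with $\#\mathcal{E}=i$. Connectivity matrix: $A=(a_{ij})_{i,j=1}^m$ with $a_{ij}=1$ if the equivalence relation on $\{k_1,\dots,k_n\}$ generated by the partitions $\mathcal{A}_i$ and $\mathcal{A}_j$ has a single class, and $a_{ij}=0$ otherwise. It is a known fact that $A$ is invertible. For a partition $\mathcal{A}$ of $\{k_1,\dots,k_n\}$ and $l\in\{1,2\}$, $G_l^{\mathcal{A}}$ is obtained from $G_l=(V,E)$ by identifying nodes lying in the same block of $\mathcal{A}$: with $\sim$ the equivalence relation on $V$ generated by $\mathcal{A}$ and $\pi:V\to V/\!\sim$ the quotient map, $G_l^{\mathcal{A}}=(V/\!\sim,\{(\{\pi(a),\pi(b)\},n):(\{a,b\},n)\in E\})$ with inherited edge parameters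 and distinguished set $K_l^{\mathcal{A}}=\pi(K_l)$. -}

module Defs where

open import Level using (Level)
open import Data.Nat as ℕ using (ℕ; zero; suc; _∸_; _≡ᵇ_)
open import Data.Fin using (Fin; zero; suc; toℕ)
open import Data.Fin.Properties using (any?; all?; _≟_)
open import Data.Fin.Subset using (Subset; _∈_)
open import Data.Fin.Subset.Properties using (_∈?_)
open import Data.Bool using (Bool; true; false; if_then_else_; _∧_)
open import Data.Vec using (Vec; []; _∷_)
import Data.Vec as Vec
open import Data.List using (List; []; _∷_; length; map; _++_; foldr)
import Data.List as List
open import Data.Product using (Σ; ∃; _×_; _,_; proj₁; proj₂)
open import Data.Sum using (_⊎_; inj₁; inj₂)
open import Data.Empty using (⊥)
open import Data.Unit using (⊤; tt)
open import Relation.Nullary using (Dec; yes; no; does)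
open import Relation.Nullary.Decidable using (_×-dec_; _⊎-dec_; _→-dec_)
open import Relation.Binary.PropositionalEquality using (_≡_; refl)
open import Relation.Binary.Construct.Closure.ReflexiveTransitive
  using (Star; ε; _◅_; _◅◅_)
open import Relation.Binary.Construct.Closure.Symmetric using (SymClosure; fwd; bwd)
open import Relation.Binary.Construct.Closure.Equivalence using (EqClosure)
open import Algebra.Bundles using (CommutativeRing)

-- Helper: reachability (reflexive-transitive closure) of a decidable
-- relation on a finite set is decidable (vertex elimination).

DecRel : ∀ {n} → (Fin n → Fin n → Set) → Set
DecRel {n} S = (x y : Fin n) → Dec (S x y)

private
  module Elim {n : ℕ} (S : Fin (suc n) → Fin (suc n) → Set) where
    S' : Fin n → Fin n → Set
    S' a b = S (suc a) (suc b) ⊎ (S (suc a) zero × S zero (suc b))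

    Reach' : Fin (suc n) → Fin (suc n) → Set
    Reach' zero    zero    = ⊤
    Reach' zero    (suc b) = ∃ λ c → S zero (suc c) × Star S' c b
    Reach' (suc a) zero    = ∃ λ c → Star S' a c × S (suc c) zero
    Reach' (suc a) (suc b) = Star S' a b

    lift : ∀ {a b} → Star S' a b → Star S (suc a) (suc b)
    lift ε = ε
    lift (inj₁ s ◅ p) = s ◅ lift p
    lift (inj₂ (s₁ , s₂) ◅ p) = s₁ ◅ s₂ ◅ lift p

    sound : ∀ x y → Reach' x y → Star S x y
    sound zero    zero    _ = ε
    sound zero    (suc b) (c , s , p) = s ◅ lift p
    sound (suc a) zero    (c , p , s) = lift p ◅◅ (s ◅ ε)
    sound (suc a) (suc b) p = lift p

    refl' : ∀ x → Reach' x x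
    refl' zero = tt
    refl' (suc a) = ε

    step : ∀ x z y → S x z → Reach' z y → Reach' x y
    step zero    zero    y       s r = r
    step zero    (suc c) zero    s r = tt
    step zero    (suc c) (suc b) s r = c , s , r
    step (suc a) zero    zero    s r = a , ε , s
    step (suc a) zero    (suc b) s (c , s' , p) = inj₂ (s , s') ◅ p
    step (suc a) (suc c) zero    s (d , p , s') = d , inj₁ s ◅ p , s'
    step (suc a) (suc c) (suc b) s r = inj₁ s ◅ r

    complete : ∀ {x y} → Star S x y → Reach' x y
    complete {x} ε = refl' x
    complete {x} {y} (_◅_ {j = z} s p) = step x z y s (complete p)

starDec : ∀ n (S : Fin n → Fin n → Set) → DecRel S → DecRel (Star S)
starDec zero S S? ()
starDec (suc n) S S? x y with reach'? x y
  where
  open Elim S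
  S'? : DecRel S'
  S'? a b = S? (suc a) (suc b) ⊎-dec (S? (suc a) zero ×-dec S? zero (suc b))
  rec : DecRel (Star S')
  rec = starDec n S' S'?
  reach'? : DecRel Reach'
  reach'? zero    zero    = yes tt
  reach'? zero    (suc b) = any? (λ c → S? zero (suc c) ×-dec rec c b)
  reach'? (suc a) zero    = any? (λ c → rec a c ×-dec S? (suc c) zero)
  reach'? (suc a) (suc b) = rec a b
... | yes r = yes (Elim.sound S x y r)
... | no ¬r = no (λ p → ¬r (Elim.complete S p))

symDec : ∀ {n} (S : Fin n → Fin n → Set) → DecRel S → DecRel (SymClosure S)
symDec S S? x y with S? x y | S? y x
... | yes s | _     = yes (fwd s)
... | no _  | yes s = yes (bwd s)
... | no ¬a | no ¬b = no λ { (fwd s) → ¬a s ; (bwd s) → ¬b s }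

eqClosureDec : ∀ {n} (S : Fin n → Fin n → Set) → DecRel S → DecRel (EqClosure S)
eqClosureDec {n} S S? = starDec n (SymClosure S) (symDec S S?)

record Edge (N : ℕ) : Set where
  constructor edge
  field
    end₁ end₂ : Fin N
    label     : ℕ
open Edge public

record Graph (N : ℕ) : Set where
  constructor graph
  field
    nodes : Subset N
    edges : List (Edge N)
open Graph public

open import Data.List.Relation.Unary.All using (All)
open import Data.List.Relation.Unary.Unique.Propositional using (Unique)

WellFormed : ∀ {N} → Graph N → Set
WellFormed g =
  All (λ e → end₁ e ∈ nodes g × end₂ e ∈ nodes g) (edges g)
  × Unique (map label (edges g))

Joins : ∀ {N} (es : List (Edge N)) → Fin (length es) → Fin N → Fin N → Set
Joins es i u v = end₁ (List.lookup es i) ≡ u × end₂ (List.lookup es i) ≡ v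

EdgeAdj : ∀ {N} → List (Edge N) → Fin N → Fin N → Set
EdgeAdj es u v = ∃ λ i → Joins es i u v

State : ∀ {N} → List (Edge N) → Set
State es = Vec Bool (length es)

ActiveAdj : ∀ {N} (es : List (Edge N)) → State es → Fin N → Fin N → Set
ActiveAdj es s u v = ∃ λ i → Vec.lookup s i ≡ true × Joins es i u v

-- Graphs presented as quotients: a generating relation Id for node
-- identification; connectivity in the quotient graph = equivalence
-- closure of (active adjacency ∪ identification).
Link : ∀ {N} (es : List (Edge N)) → (Fin N → Fin N → Set) → State es
       → Fin N → Fin N → Set
Link es Id s u v = ActiveAdj es s u v ⊎ Id u v

PathSet : ∀ {N} (es : List (Edge N)) → (Fin N → Fin N → Set) → Subset N
          → State es → Set
PathSet es Id K s = ∀ u v → u ∈ K → v ∈ K → EqClosure (Link es Id s) u v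

NoId : ∀ {N} → Fin N → Fin N → Set
NoId _ _ = ⊥

record Partition (n : ℕ) : Set where
  field
    rel      : Fin n → Fin n → Bool
    isRefl   : ∀ a → rel a a ≡ true
    isSym    : ∀ a b → rel a b ≡ true → rel b a ≡ true
    isTrans  : ∀ a b c → rel a b ≡ true → rel b c ≡ true → rel a c ≡ true
open Partition public

SamePartition : ∀ {n} → Partition n → Partition n → Set
SamePartition P Q = ∀ a b → rel P a b ≡ rel Q a b

record IsEnumeration {n m : ℕ} (Ap : Fin m → Partition n) : Set where
  field
    complete  : ∀ (P : Partition n) → ∃ λ i → SamePartition (Ap i) P
    injective : ∀ i j → SamePartition (Ap i) (Ap j) → i ≡ j

PartId : ∀ {N n} → (Fin n → Fin N) → Partition n → Fin N → Fin N → Set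
PartId k P u v = ∃ λ a → ∃ λ b → k a ≡ u × k b ≡ v × rel P a b ≡ true

OneClass : ∀ {n} → Partition n → Partition n → Set
OneClass {n} P Q =
  Fin n × (∀ a b → EqClosure (λ x y → rel P x y ≡ true ⊎ rel Q x y ≡ true) a b)

activeAdj? : ∀ {N} (es : List (Edge N)) (s : State es) → DecRel (ActiveAdj es s)
activeAdj? es s u v =
  any? λ i → (Data.Bool._≟_ (Vec.lookup s i) true)
     ×-dec ((end₁ (List.lookup es i) ≟ u) ×-dec (end₂ (List.lookup es i) ≟ v))
  where import Data.Bool

noId? : ∀ {N} → DecRel (NoId {N})
noId? _ _ = no λ ()

partId? : ∀ {N n} (k : Fin n → Fin N) (P : Partition n) → DecRel (PartId k P)
partId? k P u v = any? λ a → any? λ b →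
  (k a ≟ u) ×-dec ((k b ≟ v) ×-dec Data.Bool._≟_ (rel P a b) true)
  where import Data.Bool

pathSet? : ∀ {N} (es : List (Edge N)) (Id : Fin N → Fin N → Set) → DecRel Id
           → (K : Subset N) (s : State es) → Dec (PathSet es Id K s)
pathSet? es Id Id? K s =
  all? λ u → all? λ v → (u ∈? K) →-dec ((v ∈? K) →-dec
    eqClosureDec (Link es Id s) (λ x y → activeAdj? es s x y ⊎-dec Id? x y) u v)

oneClass? : ∀ {n} (P Q : Partition n) → Dec (OneClass P Q)
oneClass? {zero}  P Q = no λ { (() , _) }
oneClass? {suc n} P Q = Dec-map (all? λ a → all? λ b →
  eqClosureDec _ (λ x y → Data.Bool._≟_ (rel P x y) true ⊎-dec Data.Bool._≟_ (rel Q x y) true) a b)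
  where
  import Data.Bool
  Dec-map : _ → Dec (OneClass P Q)
  Dec-map (yes h) = yes (zero , h)
  Dec-map (no ¬h) = no λ { (_ , h) → ¬h h }

allStates : (n : ℕ) → List (Vec Bool n)
allStates zero    = [] ∷ []
allStates (suc n) = map (true ∷_) (allStates n) ++ map (false ∷_) (allStates n)

#up : ∀ {n} → Vec Bool n → ℕ
#up [] = 0
#up (true  ∷ s) = suc (#up s)
#up (false ∷ s) = #up s

-- Algebra over a commutative ring R (standing in for ℝ).
-- Polynomials in R[x] are represented by their coefficient sequences
-- ℕ → Carrier (all polynomials below have finite support).

module Poly {c ℓ} (R : CommutativeRing c ℓ) where
  open CommutativeRing R using (Carrier; _≈_; _+_; _*_; -_; 0#; 1#)

  ∑ : (m : ℕ) → (Fin m → Carrier) → Carrier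
  ∑ zero    f = 0#
  ∑ (suc m) f = f zero + ∑ m (λ i → f (suc i))

  sumList : List Carrier → Carrier
  sumList = foldr _+_ 0#

  _⊛_ : (ℕ → Carrier) → (ℕ → Carrier) → ℕ → Carrier
  (f ⊛ g) d = ∑ (suc d) (λ t → f (toℕ t) * g (d ∸ toℕ t))

  prob : ∀ {N} (p : ℕ → Carrier) (es : List (Edge N)) → State es → Carrier
  prob p []       []      = 1#
  prob p (e ∷ es) (b ∷ s) =
    (if b then p (label e) else (1# + - p (label e))) * prob p es s

  coeffI : ∀ {N} (p : ℕ → Carrier) (es : List (Edge N))
           (Id : Fin N → Fin N → Set) → DecRel Id → Subset N → ℕ → Carrier
  coeffI p es Id Id? K d = sumList (map
    (λ s → if (#up s ≡ᵇ d) ∧ does (pathSet? es Id Id? K s)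
           then prob p es s else 0#)
    (allStates (length es)))

  𝓘 : ∀ {N} (p : ℕ → Carrier) → Graph N → Subset N → ℕ → Carrier
  𝓘 p g K = coeffI p (edges g) NoId noId? K

  -- I_{K^𝒜}(G^𝒜): the graph G with the nodes k_a, k_b identified
  -- whenever a, b lie in the same block of 𝒜 (K^𝒜 = π(K))
  𝓘Q : ∀ {N n} (p : ℕ → Carrier) → Graph N → Subset N
       → (Fin n → Fin N) → Partition n → ℕ → Carrier
  𝓘Q p g K k P = coeffI p (edges g) (PartId k P) (partId? k P) K

  connMat : ∀ {n m} → (Fin m → Partition n) → Fin m → Fin m → Carrier
  connMat Ap i j = if does (oneClass? (Ap i) (Ap j)) then 1# else 0#

  δ : ∀ {m} → Fin m → Fin m → Carrier
  δ i j = if does (i ≟ j) then 1# else 0#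

  IsInverse : ∀ {m} → (Fin m → Fin m → Carrier) → (Fin m → Fin m → Carrier) → Set ℓ
  IsInverse {m} A B =
    (∀ i j → ∑ m (λ t → A i t * B t j) ≈ δ i j)
    × (∀ i j → ∑ m (λ t → B i t * A t j) ≈ δ i j)

  rhs : ∀ {N n m} (p : ℕ → Carrier) (G₁ G₂ : Graph N) (K₁ K₂ : Subset N)
        (k : Fin n → Fin N) (Ap : Fin m → Partition n)
        (b : Fin m → Fin m → Carrier) → ℕ → Carrier
  rhs {m = m} p G₁ G₂ K₁ K₂ k Ap b d =
    ∑ m λ i → ∑ m λ j →
      b i j * ((𝓘Q p G₁ K₁ k (Ap i) ⊛ 𝓘Q p G₂ K₂ k (Ap j)) d)

{-# OPTIONS --safe #-}
module Submission where

-- A state of G is a pair (s₁, s₂) of states of G₁ and G₂; probabilities multiply and edge counts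
-- add, so both sides are sums over such pairs and it suffices to show, for every pair,
--   [s₁s₂ is a K-PathSet of G] = ∑ᵢⱼ bᵢⱼ [s₁ is a K₁^𝒜ᵢ-PathSet of G₁^𝒜ᵢ] [s₂ is a K₂^𝒜ⱼ-PathSet of G₂^𝒜ⱼ].
-- If a node of K₁ (or K₂) is joined in s₁ (or s₂) to no kₐ, every indicator vanishes. Otherwise let
-- 𝒜ᵤ and 𝒜ᵥ be the partitions of {k₁,…,kₙ} cut out by the components of s₁ and s₂. As G₁ and G₂ meet
-- only in the kₐ, s₁ is a PathSet of G₁^𝒜ᵢ iff 𝒜ᵤ and 𝒜ᵢ generate a single class, i.e. iff aᵤᵢ = 1;
-- likewise s₂ is one of G₂^𝒜ⱼ iff aⱼᵥ = 1, and s₁s₂ is one of G iff aᵤᵥ = 1. Finally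
-- ∑ᵢⱼ aᵤᵢ bᵢⱼ aⱼᵥ = aᵤᵥ since B = A⁻¹. Every enumeration thus yields I_K(G), whence independence.

open import Defs
open import Level using (0ℓ)
open import Function using (_∘_; id; _on_; _⇔_; mk⇔; Equivalence)
import Function.Properties.Equivalence as ⇔
open import Data.Nat as ℕ using (ℕ; zero; suc; _∸_; _≡ᵇ_)
open import Data.Fin using (Fin; zero; suc; toℕ)
open import Data.Fin.Properties using (any?; all?; _≟_)
open import Data.Fin.Subset using (Subset; _∈_; _∪_; _∩_; _⊆_)
open import Data.Fin.Subset.Properties using (_∈?_; x∈p∪q⁺; x∈p∪q⁻; x∈p∩q⁺; x∈p∩q⁻)
open import Data.Bool using (Bool; true; false; if_then_else_; _∧_)
open import Data.List using (List; []; _∷_; length; map; _++_)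
import Data.List.Relation.Unary.All as All
open import Data.List.Membership.Propositional.Properties using (∈-lookup)
open import Data.Vec using (_∷_; [])
open import Data.Product using (∃; _×_; _,_; proj₁; proj₂)
import Data.Product as Product
open import Data.Product.Function.NonDependent.Propositional using (_×-⇔_)
open import Data.Sum using (_⊎_; inj₁; inj₂)
import Data.Sum as Sum
open import Relation.Nullary using (Dec; does; yes; no)
open import Relation.Nullary.Decidable using (dec-true; does-⇔; _×-dec_; _→-dec_)
open import Relation.Binary.Core using (Rel)
open import Relation.Binary.PropositionalEquality as ≡ using (_≡_; refl; cong)
open import Relation.Binary.Construct.Closure.ReflexiveTransitive using (ε; _◅_; _◅◅_)
import Relation.Binary.Construct.Closure.ReflexiveTransitive as Star
open import Relation.Binary.Construct.Closure.Symmetric using (SymClosure; fwd; bwd)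
import Relation.Binary.Construct.Closure.Symmetric as SC
open import Relation.Binary.Construct.Closure.Equivalence using (EqClosure)
import Relation.Binary.Construct.Closure.Equivalence as EC
open import Relation.Binary.Construct.Union using () renaming (_∪_ to _∪ᴿ_)
open import Algebra.Bundles using (CommutativeRing)

module _ {X : Set} where

  eqClosure-invariant : ∀ {R : Rel X 0ℓ} (Q : X → Set) → (∀ {u w} → SymClosure R u w → Q u → Q w) →
                        ∀ {u v} → EqClosure R u v → Q u → Q v
  eqClosure-invariant Q step = Star.fold (λ u v → Q u → Q v) (λ r f → f ∘ step r) id

  SymClosure-∪⁻ : ∀ {R S : Rel X 0ℓ} {u w} → SymClosure (R ∪ᴿ S) u w → SymClosure R u w ⊎ SymClosure S u w
  SymClosure-∪⁻ (fwd (inj₁ r)) = inj₁ (fwd r)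
  SymClosure-∪⁻ (fwd (inj₂ s)) = inj₂ (fwd s)
  SymClosure-∪⁻ (bwd (inj₁ r)) = inj₁ (bwd r)
  SymClosure-∪⁻ (bwd (inj₂ s)) = inj₂ (bwd s)

module Pullback {X I : Set} (k : I → X) where

  Image : Rel I 0ℓ → Rel X 0ℓ
  Image T u w = ∃ λ x → ∃ λ y → k x ≡ u × k y ≡ w × T x y

  image-endpoint : ∀ {T u w} → SymClosure (Image T) u w → ∃ λ z → k z ≡ u
  image-endpoint (fwd (x , _ , eq , _)) = x , eq
  image-endpoint (bwd (_ , y , _ , eq , _)) = y , eq

  escape : ∀ {R S : Rel X 0ℓ} {v} →
           (∀ {u w} → EqClosure R v u → SymClosure S u w → ∃ λ z → k z ≡ u) →
           ∀ {a} → EqClosure (R ∪ᴿ S) v (k a) → ∃ λ z → EqClosure R v (k z)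
  escape {R} {S} {v} exit {a} path =
    Sum.[ (λ c → a , c) , id ]′ (eqClosure-invariant Q step path (inj₁ ε))
    where
    Q : X → Set
    Q u = EqClosure R v u ⊎ ∃ λ z → EqClosure R v (k z)
    leave : ∀ {u w} → EqClosure R v u → SymClosure S u w → ∃ λ z → EqClosure R v (k z)
    leave c s with exit c s
    ... | z , refl = z , c
    step : ∀ {u w} → SymClosure (R ∪ᴿ S) u w → Q u → Q w
    step r (inj₂ found) = inj₂ found
    step r (inj₁ c) = Sum.[ (λ r′ → inj₁ (c ◅◅ r′ ◅ ε)) , (λ s → inj₂ (leave c s)) ]′ (SymClosure-∪⁻ r)

  quotient⁻ : ∀ {R : Rel X 0ℓ} {T : Rel I 0ℓ} {a b} → EqClosure (R ∪ᴿ Image T) (k a) (k b) →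
              EqClosure ((EqClosure R on k) ∪ᴿ T) a b
  quotient⁻ {R} {T} {a} path with eqClosure-invariant Q step path (a , ε , ε)
    where
    U = (EqClosure R on k) ∪ᴿ T
    Q : X → Set
    Q u = ∃ λ c → EqClosure R (k c) u × EqClosure U a c
    step : ∀ {u w} → SymClosure (R ∪ᴿ Image T) u w → Q u → Q w
    step r (c , cu , ac) with SymClosure-∪⁻ r
    ... | inj₁ r′ = c , cu ◅◅ r′ ◅ ε , ac
    ... | inj₂ (fwd (x , y , refl , refl , t)) = y , ε , ac ◅◅ fwd (inj₁ cu) ◅ fwd (inj₂ t) ◅ ε
    ... | inj₂ (bwd (x , y , refl , refl , t)) = x , ε , ac ◅◅ fwd (inj₁ cu) ◅ bwd (inj₂ t) ◅ ε
  ... | c , cb , ac = ac ◅◅ fwd (inj₁ cb) ◅ ε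

  quotient⁺ : ∀ {R : Rel X 0ℓ} {T : Rel I 0ℓ} {a b} → EqClosure ((EqClosure R on k) ∪ᴿ T) a b →
              EqClosure (R ∪ᴿ Image T) (k a) (k b)
  quotient⁺ = EC.gfold (EC.isEquivalence _) k
    Sum.[ EC.map inj₁ , (λ t → EC.return (inj₂ (_ , _ , refl , refl , t))) ]

  module _ {R₁ R₂ : Rel X 0ℓ}
    (shared₁ : ∀ {c u w} → EqClosure R₁ (k c) u → SymClosure R₂ u w → ∃ λ z → k z ≡ u)
    (shared₂ : ∀ {c u w} → EqClosure R₂ (k c) u → SymClosure R₁ u w → ∃ λ z → k z ≡ u) where

    glue⁻ : ∀ {a b} → EqClosure (R₁ ∪ᴿ R₂) (k a) (k b) →
            EqClosure ((EqClosure R₁ on k) ∪ᴿ (EqClosure R₂ on k)) a b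
    glue⁻ {a} path with eqClosure-invariant Q step path (a , inj₁ ε , ε)
      where
      U = (EqClosure R₁ on k) ∪ᴿ (EqClosure R₂ on k)
      Q : X → Set
      Q u = ∃ λ c → (EqClosure R₁ (k c) u ⊎ EqClosure R₂ (k c) u) × EqClosure U a c
      switch₁ : ∀ {c u w} → EqClosure U a c → EqClosure R₁ (k c) u → SymClosure R₂ u w → Q w
      switch₁ ac cu r with shared₁ cu r
      ... | z , refl = z , inj₂ (r ◅ ε) , ac ◅◅ fwd (inj₁ cu) ◅ ε
      switch₂ : ∀ {c u w} → EqClosure U a c → EqClosure R₂ (k c) u → SymClosure R₁ u w → Q w
      switch₂ ac cu r with shared₂ cu r
      ... | z , refl = z , inj₁ (r ◅ ε) , ac ◅◅ fwd (inj₂ cu) ◅ ε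
      step : ∀ {u w} → SymClosure (R₁ ∪ᴿ R₂) u w → Q u → Q w
      step r (c , inj₁ cu , ac) =
        Sum.[ (λ r₁ → c , inj₁ (cu ◅◅ r₁ ◅ ε) , ac) , switch₁ ac cu ]′ (SymClosure-∪⁻ r)
      step r (c , inj₂ cu , ac) =
        Sum.[ switch₂ ac cu , (λ r₂ → c , inj₂ (cu ◅◅ r₂ ◅ ε) , ac) ]′ (SymClosure-∪⁻ r)
    ... | c , inj₁ cb , ac = ac ◅◅ fwd (inj₁ cb) ◅ ε
    ... | c , inj₂ cb , ac = ac ◅◅ fwd (inj₂ cb) ◅ ε

  glue⁺ : ∀ {R₁ R₂ : Rel X 0ℓ} {a b} → EqClosure ((EqClosure R₁ on k) ∪ᴿ (EqClosure R₂ on k)) a b →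
          EqClosure (R₁ ∪ᴿ R₂) (k a) (k b)
  glue⁺ = EC.gfold (EC.isEquivalence _) k Sum.[ EC.map inj₁ , EC.map inj₂ ]

join : ∀ {N} (E₁ E₂ : List (Edge N)) → State E₁ → State E₂ → State (E₁ ++ E₂)
join []       E₂ []       s₂ = s₂
join (e ∷ E₁) E₂ (b ∷ s₁) s₂ = b ∷ join E₁ E₂ s₁ s₂

#up-join : ∀ {N} (E₁ E₂ : List (Edge N)) s₁ s₂ → #up (join E₁ E₂ s₁ s₂) ≡ #up s₁ ℕ.+ #up s₂
#up-join []       E₂ []           s₂ = refl
#up-join (e ∷ E₁) E₂ (true  ∷ s₁) s₂ = cong suc (#up-join E₁ E₂ s₁ s₂)
#up-join (e ∷ E₁) E₂ (false ∷ s₁) s₂ = #up-join E₁ E₂ s₁ s₂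

EdgesWithin : ∀ {N} → Subset N → List (Edge N) → Set
EdgesWithin V E = All.All (λ e → end₁ e ∈ V × end₂ e ∈ V) E

module _ {N : ℕ} where

  activeAdj-∷ : ∀ {E : List (Edge N)} {e b s u w} → ActiveAdj E s u w → ActiveAdj (e ∷ E) (b ∷ s) u w
  activeAdj-∷ (i , adj) = suc i , adj

  activeAdj-join⁻ : ∀ (E₁ E₂ : List (Edge N)) s₁ s₂ {u w} →
                    ActiveAdj (E₁ ++ E₂) (join E₁ E₂ s₁ s₂) u w → (ActiveAdj E₁ s₁ ∪ᴿ ActiveAdj E₂ s₂) u w
  activeAdj-join⁻ []       E₂ []       s₂ adj            = inj₂ adj
  activeAdj-join⁻ (e ∷ E₁) E₂ (b ∷ s₁) s₂ (zero  , adj) = inj₁ (zero , adj)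
  activeAdj-join⁻ (e ∷ E₁) E₂ (b ∷ s₁) s₂ (suc i , adj) =
    Sum.map₁ activeAdj-∷ (activeAdj-join⁻ E₁ E₂ s₁ s₂ (i , adj))

  activeAdj-join⁺ˡ : ∀ (E₁ E₂ : List (Edge N)) s₁ s₂ {u w} →
                     ActiveAdj E₁ s₁ u w → ActiveAdj (E₁ ++ E₂) (join E₁ E₂ s₁ s₂) u w
  activeAdj-join⁺ˡ (e ∷ E₁) E₂ (b ∷ s₁) s₂ (zero  , adj) = zero , adj
  activeAdj-join⁺ˡ (e ∷ E₁) E₂ (b ∷ s₁) s₂ (suc i , adj) = activeAdj-∷ (activeAdj-join⁺ˡ E₁ E₂ s₁ s₂ (i , adj))

  activeAdj-join⁺ʳ : ∀ (E₁ E₂ : List (Edge N)) s₁ s₂ {u w} →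
                     ActiveAdj E₂ s₂ u w → ActiveAdj (E₁ ++ E₂) (join E₁ E₂ s₁ s₂) u w
  activeAdj-join⁺ʳ []       E₂ []       s₂ adj = adj
  activeAdj-join⁺ʳ (e ∷ E₁) E₂ (b ∷ s₁) s₂ adj = activeAdj-∷ (activeAdj-join⁺ʳ E₁ E₂ s₁ s₂ adj)

  activeAdj-within : ∀ {V : Subset N} {E s u w} → EdgesWithin V E → ActiveAdj E s u w → u ∈ V × w ∈ V
  activeAdj-within wf (i , _ , refl , refl) = All.lookup wf (∈-lookup i)

  Conn : (E : List (Edge N)) → State E → Rel (Fin N) 0ℓ
  Conn E s = EqClosure (ActiveAdj E s)

  SymClosure-within : ∀ {V : Subset N} {E s u w} → EdgesWithin V E → SymClosure (ActiveAdj E s) u w → u ∈ V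
  SymClosure-within {s = s} wf (fwd adj) = proj₁ (activeAdj-within {s = s} wf adj)
  SymClosure-within {s = s} wf (bwd adj) = proj₂ (activeAdj-within {s = s} wf adj)

  Conn-within : ∀ {V : Subset N} {E s v u} → EdgesWithin V E → v ∈ V → Conn E s v u → u ∈ V
  Conn-within {V} {E} {s} wf vV c =
    eqClosure-invariant (_∈ V) (λ r _ → SymClosure-within {s = s} wf (SC.symmetric (ActiveAdj E s) r)) c vV

dec-true⁻¹ : ∀ {A : Set} (a? : Dec A) → does a? ≡ true → A
dec-true⁻¹ (yes a) _  = a
dec-true⁻¹ (no _)  ()

SameBlock : ∀ {n} → Partition n → Rel (Fin n) 0ℓ
SameBlock P a b = rel P a b ≡ true

module _ {n : ℕ} where

  coarsest : Partition n
  coarsest = record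
    { rel = λ _ _ → true ; isRefl = λ _ → refl ; isSym = λ _ _ _ → refl ; isTrans = λ _ _ _ _ _ → refl }

  OneClass-map : ∀ {P Q P′ Q′ : Partition n} →
                 (∀ {a b} → (SameBlock P ∪ᴿ SameBlock Q) a b → (SameBlock P′ ∪ᴿ SameBlock Q′) a b) →
                 OneClass P Q → OneClass P′ Q′
  OneClass-map f (a₀ , connected) = a₀ , λ a b → EC.map f (connected a b)

  OneClass-comm : ∀ {P Q : Partition n} → OneClass P Q ⇔ OneClass Q P
  OneClass-comm {P} {Q} = mk⇔ (OneClass-map {P} {Q} {Q} {P} Sum.swap) (OneClass-map {Q} {P} {P} {Q} Sum.swap)

  OneClass-cong : ∀ {P Q P′ Q′ : Partition n} → SamePartition P P′ → SamePartition Q Q′ →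
                  OneClass P Q ⇔ OneClass P′ Q′
  OneClass-cong {P} {Q} {P′} {Q′} P≈P′ Q≈Q′ = mk⇔
    (OneClass-map {P} {Q} {P′} {Q′} (Sum.map (≡.trans (≡.sym (P≈P′ _ _))) (≡.trans (≡.sym (Q≈Q′ _ _)))))
    (OneClass-map {P′} {Q′} {P} {Q} (Sum.map (≡.trans (P≈P′ _ _)) (≡.trans (Q≈Q′ _ _))))

module Connectivity {N n : ℕ} (k : Fin n → Fin N) where

  open Pullback k

  conn? : ∀ (E : List (Edge N)) s → DecRel (Conn E s)
  conn? E s = eqClosureDec (ActiveAdj E s) (activeAdj? E s)

  induced : (E : List (Edge N)) → State E → Partition n
  induced E s = record
    { rel     = λ a b → does (conn? E s (k a) (k b))
    ; isRefl  = λ a → dec-true (conn? E s _ _) ε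
    ; isSym   = λ a b ab → dec-true (conn? E s _ _) (EC.symmetric _ (sound ab))
    ; isTrans = λ a b c ab bc → dec-true (conn? E s _ _) (sound ab ◅◅ sound bc)
    }
    where
    sound : ∀ {u w} → does (conn? E s u w) ≡ true → Conn E s u w
    sound = dec-true⁻¹ (conn? E s _ _)

  induced⁺ : ∀ (E : List (Edge N)) s {a b} → Conn E s (k a) (k b) → SameBlock (induced E s) a b
  induced⁺ E s = dec-true (conn? E s _ _)

  induced⁻ : ∀ (E : List (Edge N)) s {a b} → SameBlock (induced E s) a b → Conn E s (k a) (k b)
  induced⁻ E s = dec-true⁻¹ (conn? E s _ _)

  Anchored : (E : List (Edge N)) → State E → Subset N → Set
  Anchored E s K = ∀ v → v ∈ K → ∃ λ a → Conn E s v (k a)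

  anchored? : ∀ (E : List (Edge N)) s K → Dec (Anchored E s K)
  anchored? E s K = all? λ v → (v ∈? K) →-dec any? λ a → conn? E s v (k a)

  quotient-pathSet⇔ : ∀ (E : List (Edge N)) s K A → Fin n → (∀ a → k a ∈ K) →
                      PathSet E (PartId k A) K s ⇔ (Anchored E s K × OneClass (induced E s) A)
  quotient-pathSet⇔ E s K A a₀ kK = mk⇔ to from
    where
    to : PathSet E (PartId k A) K s → Anchored E s K × OneClass (induced E s) A
    to ps = (λ v vK → escape (λ _ → image-endpoint) (ps v (k a₀) vK (kK a₀)))
          , (a₀ , λ a b → EC.map (Sum.map₁ (induced⁺ E s)) (quotient⁻ (ps (k a) (k b) (kK a) (kK b))))
    from : Anchored E s K × OneClass (induced E s) A → PathSet E (PartId k A) K s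
    from (anchored , (_ , one)) u v uK vK with anchored u uK | anchored v vK
    ... | a , ua | b , vb =
      EC.map inj₁ ua ◅◅ quotient⁺ (EC.map (Sum.map₁ (induced⁻ E s)) (one a b))
                     ◅◅ EC.symmetric _ (EC.map inj₁ vb)

  module _ {V₁ V₂ K₁ K₂ : Subset N} {E₁ E₂ : List (Edge N)}
    (wf₁ : EdgesWithin V₁ E₁) (wf₂ : EdgesWithin V₂ E₂) (K₁⊆V₁ : K₁ ⊆ V₁) (K₂⊆V₂ : K₂ ⊆ V₂)
    (shared : ∀ v → v ∈ V₁ → v ∈ V₂ → ∃ λ z → k z ≡ v)
    (kK₁ : ∀ a → k a ∈ K₁) (kK₂ : ∀ a → k a ∈ K₂)
    (s₁ : State E₁) (s₂ : State E₂) where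

    private
      R₁ = ActiveAdj E₁ s₁
      R₂ = ActiveAdj E₂ s₂
      L  = Link (E₁ ++ E₂) NoId (join E₁ E₂ s₁ s₂)

      sides : ∀ {u w} → L u w → (R₁ ∪ᴿ R₂) u w
      sides (inj₁ adj) = activeAdj-join⁻ E₁ E₂ s₁ s₂ adj

      unsides : ∀ {u w} → (R₁ ∪ᴿ R₂) u w → L u w
      unsides = inj₁ ∘ Sum.[ activeAdj-join⁺ˡ E₁ E₂ s₁ s₂ , activeAdj-join⁺ʳ E₁ E₂ s₁ s₂ ]′

      shared₁ : ∀ {v u w} → v ∈ V₁ → Conn E₁ s₁ v u → SymClosure R₂ u w → ∃ λ z → k z ≡ u
      shared₁ vV c r = shared _ (Conn-within {s = s₁} wf₁ vV c) (SymClosure-within {s = s₂} wf₂ r)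

      shared₂ : ∀ {v u w} → v ∈ V₂ → Conn E₂ s₂ v u → SymClosure R₁ u w → ∃ λ z → k z ≡ u
      shared₂ vV c r = shared _ (SymClosure-within {s = s₁} wf₁ r) (Conn-within {s = s₂} wf₂ vV c)

      kK : ∀ a → k a ∈ K₁ ∪ K₂
      kK a = x∈p∪q⁺ (inj₁ (kK₁ a))

      reach : Anchored E₁ s₁ K₁ → Anchored E₂ s₂ K₂ → ∀ u → u ∈ K₁ ∪ K₂ → ∃ λ a → EqClosure (R₁ ∪ᴿ R₂) u (k a)
      reach anchored₁ anchored₂ u uK with x∈p∪q⁻ K₁ K₂ uK
      ... | inj₁ u∈K₁ = Product.map₂ (EC.map inj₁) (anchored₁ u u∈K₁)
      ... | inj₂ u∈K₂ = Product.map₂ (EC.map inj₂) (anchored₂ u u∈K₂)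

    union-pathSet⁻ : Fin n → PathSet (E₁ ++ E₂) NoId (K₁ ∪ K₂) (join E₁ E₂ s₁ s₂) →
                     (Anchored E₁ s₁ K₁ × Anchored E₂ s₂ K₂) × OneClass (induced E₁ s₁) (induced E₂ s₂)
    union-pathSet⁻ a₀ ps =
      ( (λ v vK → escape (shared₁ (K₁⊆V₁ vK))
                         (EC.map sides (ps v (k a₀) (x∈p∪q⁺ (inj₁ vK)) (kK a₀))))
      , (λ v vK → escape (shared₂ (K₂⊆V₂ vK))
                         (EC.map (Sum.swap ∘ sides) (ps v (k a₀) (x∈p∪q⁺ (inj₂ vK)) (kK a₀)))) )
      , (a₀ , λ a b → EC.map (Sum.map (induced⁺ E₁ s₁) (induced⁺ E₂ s₂))
                        (glue⁻ (λ {c} → shared₁ (K₁⊆V₁ (kK₁ c))) (λ {c} → shared₂ (K₂⊆V₂ (kK₂ c)))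
                               (EC.map sides (ps (k a) (k b) (kK a) (kK b)))))

    union-pathSet⁺ : (Anchored E₁ s₁ K₁ × Anchored E₂ s₂ K₂) × OneClass (induced E₁ s₁) (induced E₂ s₂) →
                     PathSet (E₁ ++ E₂) NoId (K₁ ∪ K₂) (join E₁ E₂ s₁ s₂)
    union-pathSet⁺ ((anchored₁ , anchored₂) , (_ , one)) u v uK vK
      with reach anchored₁ anchored₂ u uK | reach anchored₁ anchored₂ v vK
    ... | a , ua | b , vb = EC.map unsides
      (ua ◅◅ glue⁺ (EC.map (Sum.map (induced⁻ E₁ s₁) (induced⁻ E₂ s₂)) (one a b)) ◅◅ EC.symmetric _ vb)

    union-pathSet⇔ : Fin n → PathSet (E₁ ++ E₂) NoId (K₁ ∪ K₂) (join E₁ E₂ s₁ s₂) ⇔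
                             ((Anchored E₁ s₁ K₁ × Anchored E₂ s₂ K₂) × OneClass (induced E₁ s₁) (induced E₂ s₂))
    union-pathSet⇔ a₀ = mk⇔ (union-pathSet⁻ a₀) union-pathSet⁺

module Sums {c ℓ} (R : CommutativeRing c ℓ) where

  open CommutativeRing R hiding (zero) renaming (refl to ≈-refl)
  open Poly R
  open import Algebra.Properties.Semiring.Sum semiring
    using (sum; sum-cong-≋; sum-replicate-zero; ∑-distrib-+; *-distribˡ-sum; *-distribʳ-sum)
  open import Algebra.Properties.CommutativeSemigroup *-commutativeSemigroup using (interchange; x∙yz≈y∙xz)
  open import Relation.Binary.Reasoning.Setoid setoid

  ⟦_⟧ : Bool → Carrier
  ⟦ b ⟧ = if b then 1# else 0#

  if-then-0 : ∀ b x → (if b then x else 0#) ≈ ⟦ b ⟧ * x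
  if-then-0 true  x = sym (*-identityˡ x)
  if-then-0 false x = sym (zeroˡ x)

  ∑≡sum : ∀ m (f : Fin m → Carrier) → ∑ m f ≡ sum f
  ∑≡sum zero    f = ≡.refl
  ∑≡sum (suc m) f = ≡.cong (f zero +_) (∑≡sum m (f ∘ suc))

  ∑-cong : ∀ m {f g : Fin m → Carrier} → (∀ i → f i ≈ g i) → ∑ m f ≈ ∑ m g
  ∑-cong m {f} {g} f≈g = begin
    ∑ m f  ≡⟨ ∑≡sum m f ⟩
    sum f  ≈⟨ sum-cong-≋ f≈g ⟩
    sum g  ≡⟨ ∑≡sum m g ⟨
    ∑ m g  ∎

  ∑-zero : ∀ m {f : Fin m → Carrier} → (∀ i → f i ≈ 0#) → ∑ m f ≈ 0#
  ∑-zero m {f} f≈0 = begin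
    ∑ m f            ≡⟨ ∑≡sum m f ⟩
    sum f            ≈⟨ sum-cong-≋ f≈0 ⟩
    sum {m} (λ _ → 0#) ≈⟨ sum-replicate-zero m ⟩
    0#               ∎

  ∑-*ˡ : ∀ m x (f : Fin m → Carrier) → x * ∑ m f ≈ ∑ m (λ i → x * f i)
  ∑-*ˡ m x f = begin
    x * ∑ m f              ≡⟨ ≡.cong (x *_) (∑≡sum m f) ⟩
    x * sum f              ≈⟨ *-distribˡ-sum x f ⟩
    sum (λ i → x * f i)    ≡⟨ ∑≡sum m _ ⟨
    ∑ m (λ i → x * f i)    ∎

  ∑-*ʳ : ∀ m x (f : Fin m → Carrier) → ∑ m f * x ≈ ∑ m (λ i → f i * x)
  ∑-*ʳ m x f = begin
    ∑ m f * x              ≡⟨ ≡.cong (_* x) (∑≡sum m f) ⟩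
    sum f * x              ≈⟨ *-distribʳ-sum x f ⟩
    sum (λ i → f i * x)    ≡⟨ ∑≡sum m _ ⟨
    ∑ m (λ i → f i * x)    ∎

  ∑-+ : ∀ m (f g : Fin m → Carrier) → ∑ m f + ∑ m g ≈ ∑ m (λ i → f i + g i)
  ∑-+ m f g = begin
    ∑ m f + ∑ m g              ≡⟨ ≡.cong₂ _+_ (∑≡sum m f) (∑≡sum m g) ⟩
    sum f + sum g              ≈⟨ ∑-distrib-+ f g ⟨
    sum (λ i → f i + g i)      ≡⟨ ∑≡sum m _ ⟨
    ∑ m (λ i → f i + g i)      ∎

  ∑-δ : ∀ {m} (f : Fin m → Carrier) u → ∑ m (λ i → f i * δ i u) ≈ f u
  ∑-δ {suc m} f zero    = trans (+-cong (*-identityʳ _) (∑-zero m λ _ → zeroʳ _)) (+-identityʳ _)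
  ∑-δ {suc m} f (suc u) = trans (+-cong (zeroʳ _) (∑-δ (f ∘ suc) u)) (+-identityˡ _)

  ∑-indicator-convolution : ∀ d a b → ∑ (suc d) (λ t → ⟦ a ≡ᵇ toℕ t ⟧ * ⟦ b ≡ᵇ d ∸ toℕ t ⟧) ≈ ⟦ a ℕ.+ b ≡ᵇ d ⟧
  ∑-indicator-convolution zero    zero    b = trans (+-identityʳ _) (*-identityˡ _)
  ∑-indicator-convolution zero    (suc a) b = trans (+-identityʳ _) (zeroˡ _)
  ∑-indicator-convolution (suc d) zero    b =
    trans (+-cong (*-identityˡ _) (∑-zero (suc d) λ t → zeroˡ ⟦ b ≡ᵇ suc d ∸ toℕ (suc t) ⟧)) (+-identityʳ _)
  ∑-indicator-convolution (suc d) (suc a) b =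
    trans (+-cong (zeroˡ _) (∑-indicator-convolution d a b)) (+-identityˡ _)

  ∑∑-sandwich : ∀ {m} (A B : Fin m → Fin m → Carrier) → (∀ i j → ∑ m (λ t → B i t * A t j) ≈ δ i j) →
                ∀ u v → ∑ m (λ i → ∑ m λ j → B i j * (A u i * A j v)) ≈ A u v
  ∑∑-sandwich {m} A B B*A≈I u v = begin
    ∑ m (λ i → ∑ m λ j → B i j * (A u i * A j v))  ≈⟨ ∑-cong m (λ i → ∑-cong m λ j → x∙yz≈y∙xz _ _ _) ⟩
    ∑ m (λ i → ∑ m λ j → A u i * (B i j * A j v))  ≈⟨ ∑-cong m (λ i → ∑-*ˡ m _ _) ⟨
    ∑ m (λ i → A u i * ∑ m λ j → B i j * A j v)    ≈⟨ ∑-cong m (λ i → *-congˡ (B*A≈I i v)) ⟩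
    ∑ m (λ i → A u i * δ i v)                      ≈⟨ ∑-δ (A u) v ⟩
    A u v                                          ∎

  ∑∑-gated : ∀ {m} (b : Fin m → Fin m → Carrier) (c d : Fin m → Bool) e →
             ∑ m (λ i → ∑ m λ j → b i j * (⟦ c i ⟧ * ⟦ d j ⟧)) ≈ ⟦ e ⟧ →
             ∀ x y → ∑ m (λ i → ∑ m λ j → b i j * (⟦ x ∧ c i ⟧ * ⟦ y ∧ d j ⟧)) ≈ ⟦ (x ∧ y) ∧ e ⟧
  ∑∑-gated         b c d e ∑∑≈ true  true  = ∑∑≈
  ∑∑-gated {m = m} b c d e _   true  false = ∑-zero m λ _ → ∑-zero m λ _ → trans (*-congˡ (zeroʳ _)) (zeroʳ _)
  ∑∑-gated {m = m} b c d e _   false y     = ∑-zero m λ _ → ∑-zero m λ _ → trans (*-congˡ (zeroˡ _)) (zeroʳ _)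

  ∑∑-weighted : ∀ {m} (b : Fin m → Fin m → Carrier) (f g : Fin m → Carrier) {z} x y →
                z ≈ ∑ m (λ i → ∑ m λ j → b i j * (f i * g j)) →
                z * (x * y) ≈ ∑ m (λ i → ∑ m λ j → b i j * ((f i * x) * (g j * y)))
  ∑∑-weighted {m} b f g {z} x y z≈ = begin
    z * (x * y)                                              ≈⟨ *-congʳ z≈ ⟩
    ∑ m (λ i → ∑ m λ j → b i j * (f i * g j)) * (x * y)      ≈⟨ ∑-*ʳ m _ _ ⟩
    ∑ m (λ i → ∑ m (λ j → b i j * (f i * g j)) * (x * y))    ≈⟨ ∑-cong m (λ i → ∑-*ʳ m _ _) ⟩
    ∑ m (λ i → ∑ m λ j → b i j * (f i * g j) * (x * y))      ≈⟨ ∑-cong m (λ i → ∑-cong m λ j → regroup) ⟩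
    ∑ m (λ i → ∑ m λ j → b i j * ((f i * x) * (g j * y)))    ∎
    where
    regroup : ∀ {β φ γ} → β * (φ * γ) * (x * y) ≈ β * ((φ * x) * (γ * y))
    regroup = trans (*-assoc _ _ _) (*-congˡ (interchange _ _ _ _))

  private variable S T : Set

  Σl : List S → (S → Carrier) → Carrier
  Σl xs f = sumList (map f xs)

  Σl-cong : ∀ (xs : List S) {f g : S → Carrier} → (∀ x → f x ≈ g x) → Σl xs f ≈ Σl xs g
  Σl-cong []       f≈g = ≈-refl
  Σl-cong (x ∷ xs) f≈g = +-cong (f≈g x) (Σl-cong xs f≈g)

  Σl-++ : ∀ (xs ys : List S) f → Σl (xs ++ ys) f ≈ Σl xs f + Σl ys f
  Σl-++ []       ys f = sym (+-identityˡ _)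
  Σl-++ (x ∷ xs) ys f = trans (+-congˡ (Σl-++ xs ys f)) (sym (+-assoc _ _ _))

  Σl-map : ∀ (xs : List T) (g : T → S) f → Σl (map g xs) f ≡ Σl xs (f ∘ g)
  Σl-map []       g f = ≡.refl
  Σl-map (x ∷ xs) g f = ≡.cong (f (g x) +_) (Σl-map xs g f)

  Σl-*ˡ : ∀ (xs : List S) x f → x * Σl xs f ≈ Σl xs (λ s → x * f s)
  Σl-*ˡ []       x f = zeroʳ x
  Σl-*ˡ (y ∷ xs) x f = trans (distribˡ x _ _) (+-congˡ (Σl-*ˡ xs x f))

  Σl-*-Σl : ∀ (xs : List S) (ys : List T) f g →
            Σl xs f * Σl ys g ≈ Σl xs λ x → Σl ys λ y → f x * g y
  Σl-*-Σl []       ys f g = zeroˡ _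
  Σl-*-Σl (x ∷ xs) ys f g = trans (distribʳ _ _ _) (+-cong (Σl-*ˡ ys (f x) g) (Σl-*-Σl xs ys f g))

  Σl-∑ : ∀ m (xs : List S) (f : S → Fin m → Carrier) →
         Σl xs (λ s → ∑ m (f s)) ≈ ∑ m (λ i → Σl xs (λ s → f s i))
  Σl-∑ m []       f = sym (∑-zero m λ _ → ≈-refl)
  Σl-∑ m (x ∷ xs) f = trans (+-congˡ (Σl-∑ m xs f)) (∑-+ m (f x) _)

  Σl-∑² : ∀ m m′ (xs : List S) (f : S → Fin m → Fin m′ → Carrier) →
          Σl xs (λ s → ∑ m λ i → ∑ m′ (f s i)) ≈ ∑ m (λ i → ∑ m′ λ j → Σl xs (λ s → f s i j))
  Σl-∑² m m′ xs f = trans (Σl-∑ m xs _) (∑-cong m λ i → Σl-∑ m′ xs (λ s → f s i))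

  coeff : List S → (S → ℕ) → (S → Carrier) → ℕ → Carrier
  coeff L deg w d = Σl L (λ s → ⟦ deg s ≡ᵇ d ⟧ * w s)

  ∑-coeff*coeff : ∀ m (L₁ : List S) (L₂ : List T) deg₁ deg₂ w₁ w₂ (τ₁ τ₂ : Fin m → ℕ) →
                  ∑ m (λ t → coeff L₁ deg₁ w₁ (τ₁ t) * coeff L₂ deg₂ w₂ (τ₂ t))
                  ≈ Σl L₁ λ s₁ → Σl L₂ λ s₂ →
                      ∑ m (λ t → ⟦ deg₁ s₁ ≡ᵇ τ₁ t ⟧ * ⟦ deg₂ s₂ ≡ᵇ τ₂ t ⟧) * (w₁ s₁ * w₂ s₂)
  ∑-coeff*coeff m L₁ L₂ deg₁ deg₂ w₁ w₂ τ₁ τ₂ = begin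
    ∑ m (λ t → coeff L₁ deg₁ w₁ (τ₁ t) * coeff L₂ deg₂ w₂ (τ₂ t))
      ≈⟨ ∑-cong m (λ t → Σl-*-Σl L₁ L₂ _ _) ⟩
    ∑ m (λ t → Σl L₁ λ s₁ → Σl L₂ λ s₂ → (⟦ deg₁ s₁ ≡ᵇ τ₁ t ⟧ * w₁ s₁) * (⟦ deg₂ s₂ ≡ᵇ τ₂ t ⟧ * w₂ s₂))
      ≈⟨ ∑-cong m (λ t → Σl-cong L₁ λ s₁ → Σl-cong L₂ λ s₂ → interchange _ _ _ _) ⟩
    ∑ m (λ t → Σl L₁ λ s₁ → Σl L₂ λ s₂ → e t s₁ s₂ * (w₁ s₁ * w₂ s₂))
      ≈⟨ Σl-∑ m L₁ _ ⟨
    Σl L₁ (λ s₁ → ∑ m λ t → Σl L₂ λ s₂ → e t s₁ s₂ * (w₁ s₁ * w₂ s₂))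
      ≈⟨ Σl-cong L₁ (λ s₁ → Σl-∑ m L₂ _) ⟨
    Σl L₁ (λ s₁ → Σl L₂ λ s₂ → ∑ m λ t → e t s₁ s₂ * (w₁ s₁ * w₂ s₂))
      ≈⟨ Σl-cong L₁ (λ s₁ → Σl-cong L₂ λ s₂ → ∑-*ʳ m _ _) ⟨
    Σl L₁ (λ s₁ → Σl L₂ λ s₂ → ∑ m (λ t → e t s₁ s₂) * (w₁ s₁ * w₂ s₂))  ∎
    where
    e = λ t s₁ s₂ → ⟦ deg₁ s₁ ≡ᵇ τ₁ t ⟧ * ⟦ deg₂ s₂ ≡ᵇ τ₂ t ⟧

  coeff-⊛ : ∀ (L₁ : List S) (L₂ : List T) deg₁ deg₂ w₁ w₂ d →
            (coeff L₁ deg₁ w₁ ⊛ coeff L₂ deg₂ w₂) d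
            ≈ Σl L₁ λ s₁ → Σl L₂ λ s₂ → ⟦ deg₁ s₁ ℕ.+ deg₂ s₂ ≡ᵇ d ⟧ * (w₁ s₁ * w₂ s₂)
  coeff-⊛ L₁ L₂ deg₁ deg₂ w₁ w₂ d =
    trans (∑-coeff*coeff (suc d) L₁ L₂ deg₁ deg₂ w₁ w₂ toℕ (λ t → d ∸ toℕ t))
          (Σl-cong L₁ λ s₁ → Σl-cong L₂ λ s₂ → *-congʳ (∑-indicator-convolution d (deg₁ s₁) (deg₂ s₂)))

  coeff-bilinear : ∀ {m} (L₁ : List S) (L₂ : List T) deg₁ deg₂ (b : Fin m → Fin m → Carrier)
                   (f : Fin m → S → Carrier) (g : Fin m → T → Carrier) (F : S → T → Carrier) →
                   (∀ s₁ s₂ → F s₁ s₂ ≈ ∑ m λ i → ∑ m λ j → b i j * (f i s₁ * g j s₂)) →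
                   ∀ d → Σl L₁ (λ s₁ → Σl L₂ λ s₂ → ⟦ deg₁ s₁ ℕ.+ deg₂ s₂ ≡ᵇ d ⟧ * F s₁ s₂)
                         ≈ ∑ m λ i → ∑ m λ j → b i j * (coeff L₁ deg₁ (f i) ⊛ coeff L₂ deg₂ (g j)) d
  coeff-bilinear {m = m} L₁ L₂ deg₁ deg₂ b f g F F≈ d = begin
    Σl L₁ (λ s₁ → Σl L₂ λ s₂ → e s₁ s₂ * F s₁ s₂)
      ≈⟨ Σl-cong L₁ (λ s₁ → Σl-cong L₂ λ s₂ → *-congˡ (F≈ s₁ s₂)) ⟩
    Σl L₁ (λ s₁ → Σl L₂ λ s₂ → e s₁ s₂ * ∑ m λ i → ∑ m λ j → b i j * (f i s₁ * g j s₂))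
      ≈⟨ Σl-cong L₁ (λ s₁ → Σl-cong L₂ λ s₂ → pull-in s₁ s₂) ⟩
    Σl L₁ (λ s₁ → Σl L₂ λ s₂ → ∑ m λ i → ∑ m λ j → b i j * (e s₁ s₂ * (f i s₁ * g j s₂)))
      ≈⟨ trans (Σl-cong L₁ λ s₁ → Σl-∑² m m L₂ _) (Σl-∑² m m L₁ _) ⟩
    ∑ m (λ i → ∑ m λ j → Σl L₁ λ s₁ → Σl L₂ λ s₂ → b i j * (e s₁ s₂ * (f i s₁ * g j s₂)))
      ≈⟨ ∑-cong m (λ i → ∑-cong m λ j → trans (Σl-*ˡ L₁ _ _) (Σl-cong L₁ λ s₁ → Σl-*ˡ L₂ _ _)) ⟨
    ∑ m (λ i → ∑ m λ j → b i j * Σl L₁ λ s₁ → Σl L₂ λ s₂ → e s₁ s₂ * (f i s₁ * g j s₂))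
      ≈⟨ ∑-cong m (λ i → ∑-cong m λ j → *-congˡ (coeff-⊛ L₁ L₂ deg₁ deg₂ (f i) (g j) d)) ⟨
    ∑ m (λ i → ∑ m λ j → b i j * (coeff L₁ deg₁ (f i) ⊛ coeff L₂ deg₂ (g j)) d)  ∎
    where
    e = λ s₁ s₂ → ⟦ deg₁ s₁ ℕ.+ deg₂ s₂ ≡ᵇ d ⟧
    pull-in : ∀ s₁ s₂ → e s₁ s₂ * (∑ m λ i → ∑ m λ j → b i j * (f i s₁ * g j s₂))
                        ≈ ∑ m λ i → ∑ m λ j → b i j * (e s₁ s₂ * (f i s₁ * g j s₂))
    pull-in s₁ s₂ =
      trans (∑-*ˡ m _ _) (∑-cong m λ i → trans (∑-*ˡ m _ _) (∑-cong m λ j → x∙yz≈y∙xz _ _ _))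

  module _ {N : ℕ} where

    Σl-states-join : ∀ (E₁ E₂ : List (Edge N)) (F : State (E₁ ++ E₂) → Carrier) →
                     Σl (allStates (length (E₁ ++ E₂))) F
                     ≈ Σl (allStates (length E₁)) λ s₁ → Σl (allStates (length E₂)) λ s₂ → F (join E₁ E₂ s₁ s₂)
    Σl-states-join []       E₂ F = sym (+-identityʳ _)
    Σl-states-join (e ∷ E₁) E₂ F = begin
      Σl (map (true ∷_) A ++ map (false ∷_) A) F
        ≈⟨ Σl-++ (map (true ∷_) A) _ F ⟩
      Σl (map (true ∷_) A) F + Σl (map (false ∷_) A) F
        ≡⟨ ≡.cong₂ _+_ (Σl-map A (true ∷_) F) (Σl-map A (false ∷_) F) ⟩
      Σl A (F ∘ (true ∷_)) + Σl A (F ∘ (false ∷_))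
        ≈⟨ +-cong (Σl-states-join E₁ E₂ (F ∘ (true ∷_))) (Σl-states-join E₁ E₂ (F ∘ (false ∷_))) ⟩
      Σl A₁ (G ∘ (true ∷_)) + Σl A₁ (G ∘ (false ∷_))
        ≡⟨ ≡.cong₂ _+_ (Σl-map A₁ (true ∷_) G) (Σl-map A₁ (false ∷_) G) ⟨
      Σl (map (true ∷_) A₁) G + Σl (map (false ∷_) A₁) G
        ≈⟨ Σl-++ (map (true ∷_) A₁) _ G ⟨
      Σl (map (true ∷_) A₁ ++ map (false ∷_) A₁) G  ∎
      where
      A  = allStates (length (E₁ ++ E₂))
      A₁ = allStates (length E₁)
      G  = λ (s₁ : State (e ∷ E₁)) → Σl (allStates (length E₂)) λ s₂ → F (join (e ∷ E₁) E₂ s₁ s₂)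

    prob-join : ∀ p (E₁ E₂ : List (Edge N)) s₁ s₂ →
                prob p (E₁ ++ E₂) (join E₁ E₂ s₁ s₂) ≈ prob p E₁ s₁ * prob p E₂ s₂
    prob-join p []       E₂ []       s₂ = sym (*-identityˡ _)
    prob-join p (e ∷ E₁) E₂ (b ∷ s₁) s₂ = trans (*-congˡ (prob-join p E₁ E₂ s₁ s₂)) (sym (*-assoc _ _ _))

    coeff-states-join : ∀ (E₁ E₂ : List (Edge N)) (w : State (E₁ ++ E₂) → Carrier) d →
                        coeff (allStates (length (E₁ ++ E₂))) #up w d
                        ≈ Σl (allStates (length E₁)) λ s₁ → Σl (allStates (length E₂)) λ s₂ →
                            ⟦ #up s₁ ℕ.+ #up s₂ ≡ᵇ d ⟧ * w (join E₁ E₂ s₁ s₂)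
    coeff-states-join E₁ E₂ w d =
      trans (Σl-states-join E₁ E₂ _)
            (Σl-cong (allStates (length E₁)) λ s₁ → Σl-cong (allStates (length E₂)) λ s₂ →
               reflexive (≡.cong (λ i → ⟦ i ≡ᵇ d ⟧ * w (join E₁ E₂ s₁ s₂)) (#up-join E₁ E₂ s₁ s₂)))

    coeffI≈coeff : ∀ p (E : List (Edge N)) Id Id? K d →
                   coeffI p E Id Id? K d
                   ≈ coeff (allStates (length E)) #up (λ s → ⟦ does (pathSet? E Id Id? K s) ⟧ * prob p E s) d
    coeffI≈coeff p E Id Id? K d = Σl-cong (allStates (length E)) λ s → if-∧ (#up s ≡ᵇ d) _ _
      where
      if-∧ : ∀ a b x → (if a ∧ b then x else 0#) ≈ ⟦ a ⟧ * (⟦ b ⟧ * x)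
      if-∧ true  b x = trans (if-then-0 b x) (sym (*-identityˡ _))
      if-∧ false b x = sym (zeroˡ _)

  ⊛-cong : ∀ {f f′ g g′ : ℕ → Carrier} → (∀ e → f e ≈ f′ e) → (∀ e → g e ≈ g′ e) → ∀ d → (f ⊛ g) d ≈ (f′ ⊛ g′) d
  ⊛-cong {f} {f′} {g} {g′} f≈ g≈ d =
    ∑-cong (suc d) {λ t → f (toℕ t) * g (d ∸ toℕ t)} {λ t → f′ (toℕ t) * g′ (d ∸ toℕ t)}
      (λ t → *-cong (f≈ _) (g≈ _))

  -- Without points to glue along, the connectivity matrix is zero, so it has an
  -- inverse only over the trivial ring.
  point-or-trivial : ∀ {n m} (Ap : Fin m → Partition n) (b : Fin m → Fin m → Carrier) →
                     IsEnumeration Ap → IsInverse (connMat Ap) b → Fin n ⊎ (∀ x y → x ≈ y)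
  point-or-trivial {suc n} Ap b _  _              = inj₁ zero
  point-or-trivial {zero} {m} Ap b en (A*b≈I , _) = inj₂ λ x y → trans (≈0 x) (sym (≈0 y))
    where
    i = proj₁ (IsEnumeration.complete en coarsest)
    1≈0 : 1# ≈ 0#
    1≈0 = begin
      1#                                    ≡⟨ ≡.cong ⟦_⟧ (dec-true (i ≟ i) ≡.refl) ⟨
      δ i i                                 ≈⟨ A*b≈I i i ⟨
      ∑ m (λ t → connMat Ap i t * b t i)    ≈⟨ ∑-zero m (λ t → zeroˡ _) ⟩
      0#                                    ∎
    ≈0 : ∀ x → x ≈ 0#
    ≈0 x = trans (sym (*-identityʳ x)) (trans (*-congˡ 1≈0) (zeroʳ x))

module Decomposition {c ℓ} (R : CommutativeRing c ℓ) (p : ℕ → CommutativeRing.Carrier R)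
  {N n : ℕ} {V₁ V₂ K₁ K₂ : Subset N} {E₁ E₂ : List (Edge N)} (k : Fin n → Fin N)
  (wf₁ : EdgesWithin V₁ E₁) (wf₂ : EdgesWithin V₂ E₂) (K₁⊆V₁ : K₁ ⊆ V₁) (K₂⊆V₂ : K₂ ⊆ V₂)
  (shared : ∀ v → v ∈ V₁ → v ∈ V₂ → ∃ λ z → k z ≡ v) (kK₁ : ∀ a → k a ∈ K₁) (kK₂ : ∀ a → k a ∈ K₂)
  {m : ℕ} (Ap : Fin m → Partition n) (b : Fin m → Fin m → CommutativeRing.Carrier R)
  (en : IsEnumeration Ap) (inverse : Poly.IsInverse R (Poly.connMat R Ap) b) (a₀ : Fin n) where

  open CommutativeRing R hiding (zero) renaming (refl to ≈-refl)
  open Poly R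
  open Sums R
  open Connectivity k
  open import Relation.Binary.Reasoning.Setoid setoid

  pathSetG? : ∀ s → Dec (PathSet (E₁ ++ E₂) NoId (K₁ ∪ K₂) s)
  pathSetG? = pathSet? (E₁ ++ E₂) NoId noId? (K₁ ∪ K₂)

  pathSet₁? : ∀ i s₁ → Dec (PathSet E₁ (PartId k (Ap i)) K₁ s₁)
  pathSet₁? i = pathSet? E₁ (PartId k (Ap i)) (partId? k (Ap i)) K₁

  pathSet₂? : ∀ j s₂ → Dec (PathSet E₂ (PartId k (Ap j)) K₂ s₂)
  pathSet₂? j = pathSet? E₂ (PartId k (Ap j)) (partId? k (Ap j)) K₂

  index : ∀ E → State E → Fin m
  index E s = proj₁ (IsEnumeration.complete en (induced E s))

  enumerated : ∀ E → State E → Partition n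
  enumerated E s = Ap (index E s)

  enumerated≈induced : ∀ E s → SamePartition (enumerated E s) (induced E s)
  enumerated≈induced E s = proj₂ (IsEnumeration.complete en (induced E s))

  pathSetG⇔ : ∀ s₁ s₂ → PathSet (E₁ ++ E₂) NoId (K₁ ∪ K₂) (join E₁ E₂ s₁ s₂) ⇔
                         ((Anchored E₁ s₁ K₁ × Anchored E₂ s₂ K₂) × OneClass (enumerated E₁ s₁) (enumerated E₂ s₂))
  pathSetG⇔ s₁ s₂ =
    ⇔.trans (union-pathSet⇔ wf₁ wf₂ K₁⊆V₁ K₂⊆V₂ shared kK₁ kK₂ s₁ s₂ a₀)
            (⇔.refl ×-⇔ ⇔.sym (OneClass-cong {P = enumerated E₁ s₁} {enumerated E₂ s₂} {induced E₁ s₁} {induced E₂ s₂}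
                                              (enumerated≈induced E₁ s₁) (enumerated≈induced E₂ s₂)))

  pathSet₁⇔ : ∀ i s₁ → PathSet E₁ (PartId k (Ap i)) K₁ s₁ ⇔
                       (Anchored E₁ s₁ K₁ × OneClass (enumerated E₁ s₁) (Ap i))
  pathSet₁⇔ i s₁ =
    ⇔.trans (quotient-pathSet⇔ E₁ s₁ K₁ (Ap i) a₀ kK₁)
            (⇔.refl ×-⇔ ⇔.sym (OneClass-cong {P = enumerated E₁ s₁} {Ap i} {induced E₁ s₁} {Ap i}
                                              (enumerated≈induced E₁ s₁) (λ _ _ → ≡.refl)))

  pathSet₂⇔ : ∀ j s₂ → PathSet E₂ (PartId k (Ap j)) K₂ s₂ ⇔
                       (Anchored E₂ s₂ K₂ × OneClass (Ap j) (enumerated E₂ s₂))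
  pathSet₂⇔ j s₂ =
    ⇔.trans (quotient-pathSet⇔ E₂ s₂ K₂ (Ap j) a₀ kK₂)
            (⇔.refl ×-⇔ ⇔.trans (⇔.sym (OneClass-cong {P = enumerated E₂ s₂} {Ap j} {induced E₂ s₂} {Ap j}
                                                       (enumerated≈induced E₂ s₂) (λ _ _ → ≡.refl)))
                                (OneClass-comm {P = enumerated E₂ s₂} {Q = Ap j}))

  ⟦pathSet⟧-expansion : ∀ s₁ s₂ →
    ⟦ does (pathSetG? (join E₁ E₂ s₁ s₂)) ⟧
    ≈ ∑ m λ i → ∑ m λ j → b i j * (⟦ does (pathSet₁? i s₁) ⟧ * ⟦ does (pathSet₂? j s₂) ⟧)
  ⟦pathSet⟧-expansion s₁ s₂ = begin
    ⟦ does (pathSetG? (join E₁ E₂ s₁ s₂)) ⟧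
      ≡⟨ ≡.cong ⟦_⟧ (does-⇔ (pathSetG⇔ s₁ s₂) (pathSetG? (join E₁ E₂ s₁ s₂))
                     ((anchored₁? ×-dec anchored₂?) ×-dec oneClass? _ _)) ⟩
    ⟦ (x₁ ∧ x₂) ∧ does (oneClass? (Ap u₁) (Ap u₂)) ⟧
      ≈⟨ ∑∑-gated b c₁ c₂ _ (∑∑-sandwich (connMat Ap) b (proj₂ inverse) u₁ u₂) x₁ x₂ ⟨
    ∑ m (λ i → ∑ m λ j → b i j * (⟦ x₁ ∧ c₁ i ⟧ * ⟦ x₂ ∧ c₂ j ⟧))
      ≈⟨ ∑-cong m (λ i → ∑-cong m λ j → *-congˡ (reflexive (≡.cong₂ (λ x y → ⟦ x ⟧ * ⟦ y ⟧)
           (does-⇔ (pathSet₁⇔ i s₁) (pathSet₁? i s₁) (anchored₁? ×-dec oneClass? _ _))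
           (does-⇔ (pathSet₂⇔ j s₂) (pathSet₂? j s₂) (anchored₂? ×-dec oneClass? _ _))))) ⟨
    ∑ m (λ i → ∑ m λ j → b i j * (⟦ does (pathSet₁? i s₁) ⟧ * ⟦ does (pathSet₂? j s₂) ⟧))  ∎
    where
    u₁ = index E₁ s₁
    u₂ = index E₂ s₂
    c₁ = λ i → does (oneClass? (Ap u₁) (Ap i))
    c₂ = λ j → does (oneClass? (Ap j) (Ap u₂))
    anchored₁? = anchored? E₁ s₁ K₁
    anchored₂? = anchored? E₂ s₂ K₂
    x₁ = does anchored₁?
    x₂ = does anchored₂?

  expansion : ∀ d → 𝓘 p (graph (V₁ ∪ V₂) (E₁ ++ E₂)) (K₁ ∪ K₂) d
                    ≈ rhs p (graph V₁ E₁) (graph V₂ E₂) K₁ K₂ k Ap b d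
  expansion d = begin
    𝓘 p (graph (V₁ ∪ V₂) (E₁ ++ E₂)) (K₁ ∪ K₂) d
      ≈⟨ coeffI≈coeff p (E₁ ++ E₂) NoId noId? (K₁ ∪ K₂) d ⟩
    coeff (allStates (length (E₁ ++ E₂))) #up (λ s → ⟦ does (pathSetG? s) ⟧ * prob p (E₁ ++ E₂) s) d
      ≈⟨ coeff-states-join E₁ E₂ _ d ⟩
    Σl S₁ (λ s₁ → Σl S₂ λ s₂ → ⟦ #up s₁ ℕ.+ #up s₂ ≡ᵇ d ⟧ * w (join E₁ E₂ s₁ s₂))
      ≈⟨ coeff-bilinear S₁ S₂ #up #up b w₁ w₂ _ weighted d ⟩
    ∑ m (λ i → ∑ m λ j → b i j * (coeff S₁ #up (w₁ i) ⊛ coeff S₂ #up (w₂ j)) d)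
      ≈⟨ ∑-cong m (λ i → ∑-cong m λ j → *-congˡ (⊛-cong (coeffI≈coeff p E₁ _ (partId? k (Ap i)) K₁)
                                                        (coeffI≈coeff p E₂ _ (partId? k (Ap j)) K₂) d)) ⟨
    rhs p (graph V₁ E₁) (graph V₂ E₂) K₁ K₂ k Ap b d  ∎
    where
    S₁ = allStates (length E₁)
    S₂ = allStates (length E₂)
    w : State (E₁ ++ E₂) → Carrier
    w s = ⟦ does (pathSetG? s) ⟧ * prob p (E₁ ++ E₂) s
    w₁ : Fin m → State E₁ → Carrier
    w₁ i s₁ = ⟦ does (pathSet₁? i s₁) ⟧ * prob p E₁ s₁
    w₂ : Fin m → State E₂ → Carrier
    w₂ j s₂ = ⟦ does (pathSet₂? j s₂) ⟧ * prob p E₂ s₂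
    weighted : ∀ s₁ s₂ → w (join E₁ E₂ s₁ s₂) ≈ ∑ m λ i → ∑ m λ j → b i j * (w₁ i s₁ * w₂ j s₂)
    weighted s₁ s₂ =
      trans (*-congˡ (prob-join p E₁ E₂ s₁ s₂)) (∑∑-weighted b _ _ _ _ (⟦pathSet⟧-expansion s₁ s₂))

mainTheorem4 :
    ∀ {c ℓ} (R : CommutativeRing c ℓ) (p : ℕ → CommutativeRing.Carrier R)
      {N n : ℕ} (V₁ V₂ K₁ K₂ : Subset N) (E₁ E₂ : List (Edge N))
      (k : Fin n → Fin N) →
    let open Poly R
        open CommutativeRing R using (Carrier)
        open CommutativeRing R using (_≈_)
        G₁ = graph V₁ E₁
        G₂ = graph V₂ E₂
        G = graph (V₁ ∪ V₂) (E₁ ++ E₂)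
        K = K₁ ∪ K₂
    in WellFormed G₁ → WellFormed G₂ → WellFormed G →
       K₁ ⊆ V₁ → K₂ ⊆ V₂ →
       (∀ i j → k i ≡ k j → i ≡ j) →
       (∀ v → (v ∈ K₁ ∩ K₂) ⇔ (∃ λ i → k i ≡ v)) →
       (∀ v → (v ∈ V₁ ∩ V₂) ⇔ (∃ λ i → k i ≡ v)) →
       (∀ v → v ∈ K → ∃ λ i → EqClosure (EdgeAdj (E₁ ++ E₂)) v (k i)) →
       (∀ {m} (Ap : Fin m → Partition n) (b : Fin m → Fin m → Carrier) →
          IsEnumeration Ap → IsInverse (connMat Ap) b →
          ∀ d → 𝓘 p G K d ≈ rhs p G₁ G₂ K₁ K₂ k Ap b d)
       × (∀ {m m′} (Ap : Fin m → Partition n) (b : Fin m → Fin m → Carrier)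
            (Ap′ : Fin m′ → Partition n) (b′ : Fin m′ → Fin m′ → Carrier) →
          IsEnumeration Ap → IsInverse (connMat Ap) b →
          IsEnumeration Ap′ → IsInverse (connMat Ap′) b′ →
          ∀ d → rhs p G₁ G₂ K₁ K₂ k Ap b d ≈ rhs p G₁ G₂ K₁ K₂ k Ap′ b′ d)
mainTheorem4 R p V₁ V₂ K₁ K₂ E₁ E₂ k (wf₁ , _) (wf₂ , _) _ K₁⊆V₁ K₂⊆V₂ _ hK hV _ =
  expansion , λ Ap b Ap′ b′ en inv en′ inv′ d →
    trans (sym (expansion Ap b en inv d)) (expansion Ap′ b′ en′ inv′ d)
  where
  open CommutativeRing R using (_≈_; trans; sym)
  kK : ∀ a → k a ∈ K₁ ∩ K₂
  kK a = Equivalence.from (hK (k a)) (a , refl)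
  shared : ∀ v → v ∈ V₁ → v ∈ V₂ → ∃ λ z → k z ≡ v
  shared v v∈V₁ v∈V₂ = Equivalence.to (hV v) (x∈p∩q⁺ (v∈V₁ , v∈V₂))
  expansion : ∀ {m} (Ap : Fin m → Partition _) b → IsEnumeration Ap → Poly.IsInverse R (Poly.connMat R Ap) b →
              ∀ d → Poly.𝓘 R p (graph (V₁ ∪ V₂) (E₁ ++ E₂)) (K₁ ∪ K₂) d
                    ≈ Poly.rhs R p (graph V₁ E₁) (graph V₂ E₂) K₁ K₂ k Ap b d
  expansion Ap b en inv d with Sums.point-or-trivial R Ap b en inv
  ... | inj₁ a₀      = Decomposition.expansion R p k wf₁ wf₂ K₁⊆V₁ K₂⊆V₂ shared
                         (proj₁ ∘ x∈p∩q⁻ _ _ ∘ kK) (proj₂ ∘ x∈p∩q⁻ _ _ ∘ kK) Ap b en inv a₀ d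
  ... | inj₂ trivial = trivial _ _
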